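{- Let $a,b\ge 1$ be integers, $k=a+b+1$, and let $X_i$ be an $m$-rowed simple matrix with $F_{0,k,k,0}\not\prec X_i$, all of whose columns have column sum $i$. Suppose $X_i$ is of type $(a,b)$ with associated partition $C_i\cup D_i=[m]$. Form the bipartite graph $G_i=(V_i,E_i)$ with vertex set $V_i=\binom{C_i}{a}\cup\binom{D_i}{b}$, where $(C,D)\in E_i$ (for $C\in\binom{C_i}{a}$, $D\in\binom{D_i}{b}$) if there is a column of $X_i$ with 1's in the rows of $C$ and of $D_i\setminus D$ and 0's in the rows of $D$ and of $C_i\setminus C$. Assume $|E_i|\ge 2km^{k-2}$. Then there is a subgraph $G_i'=(V_i',E_i')$ of $G_i$ with $|E_i'|\ge \frac12|E_i|$ such that for every pair $C\in\binom{C_i}{a}$, $D\in\binom{D_i}{b}$ with $(C,D)\in E_i'$ we have $d_{G_i'}(C)\ge (b+1/2)m^{b-1}$ and $d_{G_i'}(D)\ge (a+1/2)m^{a-1}$.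
   Context: A matrix is simple if it is a (0,1)-matrix with no repeated columns; $F\prec A$ means some row and column permutation of $F$ is a submatrix of $A$. $F_{0,k,k,0}$ is the $2k\times 2$ (0,1)-matrix with $k$ rows $[1\,0]$ and $k$ rows $[0\,1]$. An $m$-rowed matrix $X_i$ all of whose columns have sum $i$ is of type $(a,b)$ (integers $a,b\ge0$ with $a+b=k-1$) if there is a partition $C_i\cup D_i=[m]$ with $|D_i|+a-b=i$ such that every column of $X_i$ has exactly $a$ 1's in the rows $C_i$ and exactly $b$ 0's in the rows $D_i$. $d_{G}(v)$ denotes the degree of vertex $v$ in graph $G$. -}

module Defs where

open import Data.Bool using (Bool; true; false; not; _∧_; _∨_; if_then_else_)
open import Data.Nat using (ℕ; zero; suc; _+_; _≡ᵇ_)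
open import Data.Fin using (Fin; zero; suc; splitAt)
open import Data.Sum using (inj₁; inj₂)
open import Data.Vec using (Vec; []; _∷_; lookup)
open import Data.List using (List; []; _∷_; _++_; map)
open import Data.Nat.ListAction using (sum)
open import Data.Product using (Σ; _×_)
open import Function.Definitions using (Injective)
open import Relation.Binary.PropositionalEquality using (_≡_)

Matrix : ℕ → ℕ → Set
Matrix m n = Fin m → Fin n → Bool

Simple : ∀ {m n} → Matrix m n → Set
Simple {m} {n} X = ∀ (j j' : Fin n) → (∀ (r : Fin m) → X r j ≡ X r j') → j ≡ j'

-- F ≺ A : some row and column permutation of F is a submatrix of A,
-- i.e. there are injective maps of rows and columns of F into those of A
-- under which the entries agree.
_≺_ : ∀ {r c m n} → Matrix r c → Matrix m n → Set
_≺_ {r} {c} {m} {n} F A =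
  Σ (Fin r → Fin m) λ ρ → Σ (Fin c → Fin n) λ σ →
    Injective _≡_ _≡_ ρ × Injective _≡_ _≡_ σ × (∀ i j → F i j ≡ A (ρ i) (σ j))

F0kk0 : (k : ℕ) → Matrix (k + k) 2
F0kk0 k i j with splitAt k i | j
... | inj₁ _ | zero = true
... | inj₁ _ | suc _ = false
... | inj₂ _ | zero = false
... | inj₂ _ | suc _ = true

allFin : ∀ {m} → (Fin m → Bool) → Bool
allFin {zero} f = true
allFin {suc m} f = f zero ∧ allFin (λ r → f (suc r))

anyFin : ∀ {m} → (Fin m → Bool) → Bool
anyFin {zero} f = false
anyFin {suc m} f = f zero ∨ anyFin (λ r → f (suc r))

bit : Bool → ℕ
bit true = 1
bit false = 0

countTrue : ∀ {m} → (Fin m → Bool) → ℕ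
countTrue {zero} f = 0
countTrue {suc m} f = bit (f zero) + countTrue (λ r → f (suc r))

eqB : Bool → Bool → Bool
eqB true y = y
eqB false y = not y

-- Subsets of [m]: Vec Bool m (as Data.Fin.Subset); true = member.
Sub : ℕ → Set
Sub m = Vec Bool m

card : ∀ {m} → Sub m → ℕ
card {m} S = countTrue (lookup S)

compl : ∀ {m} → Sub m → Sub m
compl [] = []
compl (x ∷ S) = not x ∷ compl S

subsetB : ∀ {m} → Sub m → Sub m → Bool
subsetB S T = allFin (λ r → not (lookup S r) ∨ lookup T r)

allSubs : (m : ℕ) → List (Sub m)
allSubs zero = [] ∷ []
allSubs (suc m) = map (false ∷_) (allSubs m) ++ map (true ∷_) (allSubs m)

colSum : ∀ {m n} → Matrix m n → Fin n → ℕ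
colSum X j = countTrue (λ r → X r j)

-- X (all columns of sum i) is of type (a,b) w.r.t. partition C_i ∪ D_i = [m],
-- where C_i = Ci and D_i = complement of Ci:
--  |D_i| + a - b = i, every column has exactly a 1's in C_i and
--  exactly b 0's in D_i.
IsType : ∀ {m n} → (a b i : ℕ) → Matrix m n → Sub m → Set
IsType {m} {n} a b i X Ci =
  (card (compl Ci) + a ≡ i + b) ×
  (∀ (j : Fin n) → countTrue (λ r → lookup Ci r ∧ X r j) ≡ a) ×
  (∀ (j : Fin n) → countTrue (λ r → not (lookup Ci r) ∧ not (X r j)) ≡ b)

edgeB : ∀ {m n} → (a b : ℕ) → Matrix m n → Sub m → Sub m → Sub m → Bool
edgeB {m} {n} a b X Ci C D =
  subsetB C Ci ∧ (card C ≡ᵇ a) ∧ subsetB D (compl Ci) ∧ (card D ≡ᵇ b) ∧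
  anyFin {n} (λ j → allFin {m} (λ r →
    if lookup Ci r
      then eqB (X r j) (lookup C r)
      else eqB (X r j) (not (lookup D r))))

EdgeSet : ℕ → Set
EdgeSet m = Sub m → Sub m → Bool

numEdges : ∀ {m} → EdgeSet m → ℕ
numEdges {m} E = sum (map (λ C → sum (map (λ D → bit (E C D)) (allSubs m))) (allSubs m))

degC : ∀ {m} → EdgeSet m → Sub m → ℕ
degC {m} E C = sum (map (λ D → bit (E C D)) (allSubs m))

degD : ∀ {m} → EdgeSet m → Sub m → ℕ
degD {m} E D = sum (map (λ C → bit (E C D)) (allSubs m))

-- Repeatedly delete a vertex C
-- (resp. D) of positive degree d with 2d below its threshold T. The potential
--   2|E| + T_C · #(isolated C) + T_D · #(isolated D)
-- never decreases (a deletion lowers 2|E| by 2d < T and isolates one more vertex), and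
-- the process stops at a subgraph in which every non-isolated vertex meets its threshold.
-- Comparing the potential at the start and at the end, with at most m^a sets C and m^b
-- sets D, and T_C m^a + T_D m^b = 2k m^(k-2) ≤ |E|, shows that at least half the edges
-- survive.
module Submission where

open import Defs
open import Data.Bool using (Bool; true; false; _∧_; if_then_else_)
open import Data.Bool.Properties using () renaming (_≟_ to _≟ᵇ_)
open import Data.Nat using (ℕ; zero; suc; _+_; _*_; _∸_; _^_; _≤_; _<_; _≡ᵇ_; z≤n; _<?_)
open import Data.Nat.Properties
open import Data.Nat.Induction using (<-wellFounded)
open import Data.Nat.ListAction using (sum)
open import Data.Nat.ListAction.Properties using (sum-++)
open import Data.Nat.Tactic.RingSolver using (solve-∀)
open import Data.Fin using (Fin)
open import Data.Vec using ([]; _∷_)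
open import Data.Vec.Properties using (≡-dec)
open import Data.List using (List; []; _∷_; _++_; map)
open import Data.List.Properties using (map-++; map-∘)
open import Data.List.Membership.Propositional using (_∈_; lose)
open import Data.List.Membership.Propositional.Properties using (∈-map⁺; ∈-++⁺ˡ; ∈-++⁺ʳ)
open import Data.List.Relation.Unary.Any using (here; there; any?; satisfied)
open import Data.Empty using (⊥-elim)
open import Data.Product using (Σ; ∃; _×_; _,_; proj₁; proj₂)
open import Data.Sum using (_⊎_; inj₁; inj₂)
open import Induction.WellFounded using (Acc; acc)
open import Relation.Nullary using (¬_; Dec; yes; no; isYes)
open import Relation.Nullary.Decidable using (_×-dec_)
open import Relation.Unary using (Decidable)
open import Relation.Binary.Definitions using (DecidableEquality)
open import Relation.Binary.PropositionalEquality
  using (_≡_; _≢_; refl; sym; trans; cong; cong₂; module ≡-Reasoning)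

∑ : {A : Set} → List A → (A → ℕ) → ℕ
∑ xs f = sum (map f xs)

module _ {A : Set} where

  ∑-mono : ∀ xs {f g : A → ℕ} → (∀ x → f x ≤ g x) → ∑ xs f ≤ ∑ xs g
  ∑-mono []       f≤g = z≤n
  ∑-mono (x ∷ xs) f≤g = +-mono-≤ (f≤g x) (∑-mono xs f≤g)

  ∑-mono-< : ∀ xs {f g : A → ℕ} → (∀ x → f x ≤ g x) →
             ∀ {x} → x ∈ xs → f x < g x → ∑ xs f < ∑ xs g
  ∑-mono-< (y ∷ xs) f≤g (here refl)  fx<gx = +-mono-<-≤ fx<gx (∑-mono xs f≤g)
  ∑-mono-< (y ∷ xs) f≤g (there x∈xs) fx<gx = +-mono-≤-< (f≤g y) (∑-mono-< xs f≤g x∈xs fx<gx)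

  ∈⇒≤∑ : ∀ {xs} (f : A → ℕ) {x} → x ∈ xs → f x ≤ ∑ xs f
  ∈⇒≤∑ {y ∷ xs} f (here refl)  = m≤m+n (f y) (∑ xs f)
  ∈⇒≤∑ {y ∷ xs} f (there x∈xs) = ≤-trans (∈⇒≤∑ f x∈xs) (m≤n+m (∑ xs f) (f y))

  ∑-++ : ∀ xs ys (f : A → ℕ) → ∑ (xs ++ ys) f ≡ ∑ xs f + ∑ ys f
  ∑-++ xs ys f = trans (cong sum (map-++ f xs ys)) (sum-++ (map f xs) (map f ys))

  ∑-zero : ∀ xs → ∑ xs (λ (_ : A) → 0) ≡ 0
  ∑-zero []       = refl
  ∑-zero (x ∷ xs) = ∑-zero xs

  ∑-distrib-+ : ∀ xs (f g : A → ℕ) → ∑ xs (λ x → f x + g x) ≡ ∑ xs f + ∑ xs g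
  ∑-distrib-+ []       f g = refl
  ∑-distrib-+ (x ∷ xs) f g = trans (cong (f x + g x +_) (∑-distrib-+ xs f g))
                                   (+-interchange (f x) (g x) (∑ xs f) (∑ xs g))
    where
    +-interchange : ∀ p q r s → p + q + (r + s) ≡ p + r + (q + s)
    +-interchange = solve-∀

  *-distribˡ-∑ : ∀ xs c (f : A → ℕ) → ∑ xs (λ x → c * f x) ≡ c * ∑ xs f
  *-distribˡ-∑ []       c f = sym (*-zeroʳ c)
  *-distribˡ-∑ (x ∷ xs) c f = trans (cong (c * f x +_) (*-distribˡ-∑ xs c f))
                                    (sym (*-distribˡ-+ c (f x) (∑ xs f)))

∑-map : {A B : Set} (g : A → B) (xs : List A) (f : B → ℕ) → ∑ (map g xs) f ≡ ∑ xs (λ x → f (g x))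
∑-map g xs f = cong sum (sym (map-∘ xs))

∑-comm : {A B : Set} (xs : List A) (ys : List B) (h : A → B → ℕ) →
         ∑ xs (λ x → ∑ ys (h x)) ≡ ∑ ys (λ y → ∑ xs (λ x → h x y))
∑-comm []       ys h = sym (∑-zero ys)
∑-comm (x ∷ xs) ys h = begin
    ∑ ys (h x) + ∑ xs (λ x → ∑ ys (h x))
  ≡⟨ cong (∑ ys (h x) +_) (∑-comm xs ys h) ⟩
    ∑ ys (h x) + ∑ ys (λ y → ∑ xs (λ x → h x y))
  ≡⟨ sym (∑-distrib-+ ys (h x) (λ y → ∑ xs (λ x → h x y))) ⟩
    ∑ ys (λ y → h x y + ∑ xs (λ x → h x y)) ∎
  where open ≡-Reasoning

bit-mono : ∀ {x y} → (x ≡ true → y ≡ true) → bit x ≤ bit y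
bit-mono {false} x⇒y = z≤n
bit-mono {true}  x⇒y rewrite x⇒y refl = ≤-refl

bit-∧≤ : ∀ x y → bit (x ∧ y) ≤ bit x
bit-∧≤ true  y = bit-mono (λ _ → refl)
bit-∧≤ false y = z≤n

∧-true : ∀ x {y} → x ∧ y ≡ true → x ≡ true × y ≡ true
∧-true true y≡true = refl , y≡true

∈-allSubs : ∀ {m} (T : Sub m) → T ∈ allSubs m
∈-allSubs []                  = here refl
∈-allSubs {suc m} (false ∷ T) = ∈-++⁺ˡ (∈-map⁺ (false ∷_) (∈-allSubs T))
∈-allSubs {suc m} (true ∷ T)  =
  ∈-++⁺ʳ (map (false ∷_) (allSubs m)) (∈-map⁺ (true ∷_) (∈-allSubs T))

#subsetsOfSize : ℕ → ℕ → ℕ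
#subsetsOfSize m a = ∑ (allSubs m) (λ T → bit (card T ≡ᵇ a))

#subsetsOfSize-suc : ∀ m a → #subsetsOfSize (suc m) a ≡
  #subsetsOfSize m a + ∑ (allSubs m) (λ T → bit (suc (card T) ≡ᵇ a))
#subsetsOfSize-suc m a =
  trans (∑-++ (map (false ∷_) (allSubs m)) (map (true ∷_) (allSubs m)) _)
        (cong₂ _+_ (∑-map (false ∷_) (allSubs m) _) (∑-map (true ∷_) (allSubs m) _))

#subsetsOfSize≤^ : ∀ m a → #subsetsOfSize m a ≤ m ^ a
#subsetsOfSize≤^ zero    zero    = ≤-refl
#subsetsOfSize≤^ zero    (suc a) = z≤n
#subsetsOfSize≤^ (suc m) zero    rewrite #subsetsOfSize-suc m zero | ∑-zero (allSubs m)
                                       | +-identityʳ (#subsetsOfSize m zero) = #subsetsOfSize≤^ m zero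
#subsetsOfSize≤^ (suc m) (suc a) rewrite #subsetsOfSize-suc m (suc a) = begin
    #subsetsOfSize m (suc a) + #subsetsOfSize m a
  ≤⟨ +-mono-≤ (#subsetsOfSize≤^ m (suc a)) (#subsetsOfSize≤^ m a) ⟩
    m * m ^ a + m ^ a
  ≡⟨ +-comm (m * m ^ a) (m ^ a) ⟩
    suc m * m ^ a
  ≤⟨ *-monoʳ-≤ (suc m) (^-monoˡ-≤ a (n≤1+n m)) ⟩
    suc m * suc m ^ a ∎
  where open ≤-Reasoning

module Pruning {V : Set} (_≟_ : DecidableEquality V) (vs : List V) (∈-vs : ∀ v → v ∈ vs) where

  Graph : Set
  Graph = V → V → Bool

  transpose : Graph → Graph
  transpose E w u = E u w

  degˡ : Graph → V → ℕ
  degˡ E u = ∑ vs (λ w → bit (E u w))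

  degʳ : Graph → V → ℕ
  degʳ E = degˡ (transpose E)

  edges : Graph → ℕ
  edges E = ∑ vs (degˡ E)

  _⊆_ : Graph → Graph → Set
  E' ⊆ E = ∀ u w → E' u w ≡ true → E u w ≡ true

  ⊆-trans : ∀ {E₁ E₂ E₃} → E₁ ⊆ E₂ → E₂ ⊆ E₃ → E₁ ⊆ E₃
  ⊆-trans E₁⊆E₂ E₂⊆E₃ u w e = E₂⊆E₃ u w (E₁⊆E₂ u w e)

  edges-transpose : ∀ E → edges (transpose E) ≡ edges E
  edges-transpose E = ∑-comm vs vs (λ w u → bit (E u w))

  degˡ-mono : ∀ {E' E} → E' ⊆ E → ∀ u → degˡ E' u ≤ degˡ E u
  degˡ-mono E'⊆E u = ∑-mono vs (λ w → bit-mono (E'⊆E u w))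

  edge⇒degˡ-pos : ∀ E {u w} → E u w ≡ true → 0 < degˡ E u
  edge⇒degˡ-pos E {u} {w} e =
    ≤-trans (≤-reflexive (cong bit (sym e))) (∈⇒≤∑ (λ w → bit (E u w)) (∈-vs w))

  deleteˡ : V → Graph → Graph
  deleteˡ u₀ E u w = if isYes (u ≟ u₀) then false else E u w

  deleteʳ : V → Graph → Graph
  deleteʳ w₀ E = transpose (deleteˡ w₀ (transpose E))

  deleteˡ-⊆ : ∀ {u₀} E → deleteˡ u₀ E ⊆ E
  deleteˡ-⊆ {u₀} E u w e with u ≟ u₀
  ... | no _ = e

  degˡ-deleteˡ-self : ∀ u₀ E → degˡ (deleteˡ u₀ E) u₀ ≡ 0
  degˡ-deleteˡ-self u₀ E with u₀ ≟ u₀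
  ... | yes _      = ∑-zero vs
  ... | no u₀≢u₀ = ⊥-elim (u₀≢u₀ refl)

  degˡ-deleteˡ-other : ∀ {u₀ u} E → u ≢ u₀ → degˡ (deleteˡ u₀ E) u ≡ degˡ E u
  degˡ-deleteˡ-other {u₀} {u} E u≢u₀ with u ≟ u₀
  ... | yes u≡u₀ = ⊥-elim (u≢u₀ u≡u₀)
  ... | no _     = refl

  deleteˡ-removes-edges : ∀ {u₀} E → 0 < degˡ E u₀ → edges (deleteˡ u₀ E) < edges E
  deleteˡ-removes-edges {u₀} E pos = ∑-mono-< vs (degˡ-mono (deleteˡ-⊆ E)) (∈-vs u₀)
    (≤-<-trans (≤-reflexive (degˡ-deleteˡ-self u₀ E)) pos)

  deleteʳ-removes-edges : ∀ {w₀} E → 0 < degʳ E w₀ → edges (deleteʳ w₀ E) < edges E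
  deleteʳ-removes-edges {w₀} E pos = begin-strict
    edges (deleteʳ w₀ E)                 ≡⟨ edges-transpose (deleteˡ w₀ (transpose E)) ⟩
    edges (deleteˡ w₀ (transpose E))     <⟨ deleteˡ-removes-edges (transpose E) pos ⟩
    edges (transpose E)                  ≡⟨ edges-transpose E ⟩
    edges E                              ∎
    where open ≤-Reasoning

  weight : (V → Bool) → ℕ → V → ℕ → ℕ
  weight A T u d = 2 * d + T * bit (A u ∧ (d ≡ᵇ 0))

  weight-isolate : ∀ A T {u d} → A u ≡ true → 0 < d → 2 * d < T → weight A T u d ≤ weight A T u 0
  weight-isolate A T {u} {suc d} Au _ 2d<T rewrite Au = begin
    2 * suc d + T * 0   ≡⟨ cong (2 * suc d +_) (*-zeroʳ T) ⟩
    2 * suc d + 0       ≡⟨ +-identityʳ (2 * suc d) ⟩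
    2 * suc d           ≤⟨ <⇒≤ 2d<T ⟩
    T                   ≡⟨ sym (*-identityʳ T) ⟩
    T * 1               ∎
    where open ≤-Reasoning

  isolated : (V → Bool) → Graph → ℕ
  isolated A E = ∑ vs (λ u → bit (A u ∧ (degˡ E u ≡ᵇ 0)))

  isolated-antitone : ∀ A {E' E} → E' ⊆ E → isolated A E ≤ isolated A E'
  isolated-antitone A E'⊆E = ∑-mono vs λ u → isZero-antitone (A u) (degˡ-mono E'⊆E u)
    where
    isZero-antitone : ∀ x {n' n} → n' ≤ n → bit (x ∧ (n ≡ᵇ 0)) ≤ bit (x ∧ (n' ≡ᵇ 0))
    isZero-antitone false             _ = z≤n
    isZero-antitone true {zero}  {zero}  _ = ≤-refl
    isZero-antitone true {suc _} {zero}  ()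
    isZero-antitone true {_}     {suc _} _ = z≤n

  size : (V → Bool) → ℕ
  size A = ∑ vs (λ u → bit (A u))

  isolated≤size : ∀ A E → isolated A E ≤ size A
  isolated≤size A E = ∑-mono vs (λ u → bit-∧≤ (A u) _)

  potential : (V → Bool) → ℕ → (V → Bool) → ℕ → Graph → ℕ
  potential A TA B TB E = 2 * edges E + TA * isolated A E + TB * isolated B (transpose E)

  potential-weights : ∀ A TA B TB E →
    potential A TA B TB E ≡ ∑ vs (λ u → weight A TA u (degˡ E u)) + TB * isolated B (transpose E)
  potential-weights A TA B TB E = cong (_+ TB * isolated B (transpose E)) (sym (begin
    ∑ vs (λ u → 2 * degˡ E u + TA * bit (A u ∧ (degˡ E u ≡ᵇ 0)))
      ≡⟨ ∑-distrib-+ vs (λ u → 2 * degˡ E u) (λ u → TA * bit (A u ∧ (degˡ E u ≡ᵇ 0))) ⟩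
    ∑ vs (λ u → 2 * degˡ E u) + ∑ vs (λ u → TA * bit (A u ∧ (degˡ E u ≡ᵇ 0)))
      ≡⟨ cong₂ _+_ (*-distribˡ-∑ vs 2 (degˡ E)) (*-distribˡ-∑ vs TA _) ⟩
    2 * edges E + TA * isolated A E ∎))
    where open ≡-Reasoning

  potential-transpose : ∀ A TA B TB E → potential A TA B TB E ≡ potential B TB A TA (transpose E)
  potential-transpose A TA B TB E rewrite edges-transpose E =
    +-assoc-comm (2 * edges E) (TA * isolated A E) (TB * isolated B (transpose E))
    where
    +-assoc-comm : ∀ p q r → p + q + r ≡ p + r + q
    +-assoc-comm = solve-∀

  Violatorˡ : (V → Bool) → ℕ → Graph → V → Set
  Violatorˡ A T E u = A u ≡ true × 0 < degˡ E u × 2 * degˡ E u < T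

  Violatorʳ : (V → Bool) → ℕ → Graph → V → Set
  Violatorʳ B T E = Violatorˡ B T (transpose E)

  violatorˡ? : ∀ A T E → Decidable (Violatorˡ A T E)
  violatorˡ? A T E u = (A u ≟ᵇ true) ×-dec (0 <? degˡ E u) ×-dec (2 * degˡ E u <? T)

  deleteˡ-raises-potential : ∀ A TA B TB E {u₀} → Violatorˡ A TA E u₀ →
    potential A TA B TB E ≤ potential A TA B TB (deleteˡ u₀ E)
  deleteˡ-raises-potential A TA B TB E {u₀} (Au₀ , pos , small) = begin
    potential A TA B TB E
      ≡⟨ potential-weights A TA B TB E ⟩
    ∑ vs (λ u → weight A TA u (degˡ E u)) + TB * isolated B (transpose E)
      ≤⟨ +-mono-≤ (∑-mono vs (λ u → weight-rises u (u ≟ u₀)))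
                  (*-monoʳ-≤ TB (isolated-antitone B (λ w u → deleteˡ-⊆ E u w))) ⟩
    ∑ vs (λ u → weight A TA u (degˡ E₁ u)) + TB * isolated B (transpose E₁)
      ≡⟨ potential-weights A TA B TB E₁ ⟨
    potential A TA B TB E₁ ∎
    where
    open ≤-Reasoning
    E₁ = deleteˡ u₀ E
    weight-rises : ∀ u → Dec (u ≡ u₀) → weight A TA u (degˡ E u) ≤ weight A TA u (degˡ E₁ u)
    weight-rises u (no u≢u₀) = ≤-reflexive (cong (weight A TA u) (sym (degˡ-deleteˡ-other E u≢u₀)))
    weight-rises u (yes refl) rewrite degˡ-deleteˡ-self u₀ E = weight-isolate A TA Au₀ pos small

  deleteʳ-raises-potential : ∀ A TA B TB E {w₀} → Violatorʳ B TB E w₀ →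
    potential A TA B TB E ≤ potential A TA B TB (deleteʳ w₀ E)
  deleteʳ-raises-potential A TA B TB E {w₀} v = begin
    potential A TA B TB E                           ≡⟨ potential-transpose A TA B TB E ⟩
    potential B TB A TA (transpose E)               ≤⟨ deleteˡ-raises-potential B TB A TA (transpose E) v ⟩
    potential B TB A TA (deleteˡ w₀ (transpose E))  ≡⟨ potential-transpose A TA B TB (deleteʳ w₀ E) ⟨
    potential A TA B TB (deleteʳ w₀ E)              ∎
    where open ≤-Reasoning

  Admissible : (V → Bool) → (V → Bool) → Graph → Set
  Admissible A B E = ∀ u w → E u w ≡ true → A u ≡ true × B w ≡ true

  Balanced : ℕ → ℕ → Graph → Set
  Balanced TA TB E = ∀ u w → E u w ≡ true → TA ≤ 2 * degˡ E u × TB ≤ 2 * degʳ E w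

  module _ (A : V → Bool) (TA : ℕ) (B : V → Bool) (TB : ℕ) where

    Violator : Graph → Set
    Violator E = ∃ (Violatorˡ A TA E) ⊎ ∃ (Violatorʳ B TB E)

    violator-or-balanced : ∀ E → Admissible A B E → Violator E ⊎ Balanced TA TB E
    violator-or-balanced E adm
      with any? (violatorˡ? A TA E) vs | any? (violatorˡ? B TB (transpose E)) vs
    ... | yes ∃u | _      = inj₁ (inj₁ (satisfied ∃u))
    ... | no _   | yes ∃w = inj₁ (inj₂ (satisfied ∃w))
    ... | no ¬∃u | no ¬∃w = inj₂ λ u w e →
      ≮⇒≥ (λ small → ¬∃u (lose (∈-vs u) (proj₁ (adm u w e) , edge⇒degˡ-pos E e , small))) ,
      ≮⇒≥ (λ small → ¬∃w (lose (∈-vs w) (proj₂ (adm u w e) , edge⇒degˡ-pos (transpose E) e , small)))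

    delete-violator : ∀ E → Violator E →
      Σ Graph λ E₁ → E₁ ⊆ E × edges E₁ < edges E × potential A TA B TB E ≤ potential A TA B TB E₁
    delete-violator E (inj₁ (u₀ , v)) =
      deleteˡ u₀ E , deleteˡ-⊆ E , deleteˡ-removes-edges E (proj₁ (proj₂ v)) ,
      deleteˡ-raises-potential A TA B TB E v
    delete-violator E (inj₂ (w₀ , v)) =
      deleteʳ w₀ E , (λ u w → deleteˡ-⊆ (transpose E) w u) ,
      deleteʳ-removes-edges E (proj₁ (proj₂ v)) , deleteʳ-raises-potential A TA B TB E v

    prune : ∀ E → Admissible A B E → Acc _<_ (edges E) →
      Σ Graph λ E' → E' ⊆ E × Balanced TA TB E' × potential A TA B TB E ≤ potential A TA B TB E'
    prune E adm (acc rs) with violator-or-balanced E adm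
    ... | inj₂ balanced = E , (λ u w e → e) , balanced , ≤-refl
    ... | inj₁ v with delete-violator E v
    ...   | E₁ , E₁⊆E , fewer , Φ≤ with prune E₁ (λ u w e → adm u w (E₁⊆E u w e)) (rs fewer)
    ...     | E' , E'⊆E₁ , balanced , Φ≤' = E' , ⊆-trans E'⊆E₁ E₁⊆E , balanced , ≤-trans Φ≤ Φ≤'

    prune-keeps-half : ∀ E₀ → Admissible A B E₀ → TA * size A + TB * size B ≤ edges E₀ →
      Σ Graph λ E' → E' ⊆ E₀ × edges E₀ ≤ 2 * edges E' × Balanced TA TB E'
    prune-keeps-half E₀ adm budget with prune E₀ adm (<-wellFounded (edges E₀))
    ... | E' , E'⊆E₀ , balanced , Φ≤ = E' , E'⊆E₀ , +-cancelʳ-≤ e₀ e₀ (2 * edges E') half , balanced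
      where
      open ≤-Reasoning
      e₀ = edges E₀
      half : e₀ + e₀ ≤ 2 * edges E' + e₀
      half = begin
        e₀ + e₀                                       ≡⟨ cong (e₀ +_) (+-identityʳ e₀) ⟨
        2 * e₀                                        ≤⟨ m≤m+n (2 * e₀) _ ⟩
        2 * e₀ + TA * isolated A E₀                   ≤⟨ m≤m+n _ _ ⟩
        potential A TA B TB E₀                        ≤⟨ Φ≤ ⟩
        potential A TA B TB E'                        ≤⟨ +-mono-≤ (+-monoʳ-≤ (2 * edges E')
                                                            (*-monoʳ-≤ TA (isolated≤size A E')))
                                                            (*-monoʳ-≤ TB (isolated≤size B (transpose E'))) ⟩
        2 * edges E' + TA * size A + TB * size B      ≤⟨ ≤-reflexive (+-assoc (2 * edges E') _ _) ⟩
        2 * edges E' + (TA * size A + TB * size B)    ≤⟨ +-monoʳ-≤ (2 * edges E') budget ⟩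
        2 * edges E' + e₀                             ∎

edgeB-admissible : ∀ {m n} a b (X : Matrix m n) Ci (C D : Sub m) → edgeB a b X Ci C D ≡ true →
  (card C ≡ᵇ a) ≡ true × (card D ≡ᵇ b) ≡ true
edgeB-admissible a b X Ci C D e =
  let _  , e₁ = ∧-true (subsetB C Ci) e
      Ca , e₂ = ∧-true (card C ≡ᵇ a) e₁
      _  , e₃ = ∧-true (subsetB D (compl Ci)) e₂
      Db , _  = ∧-true (card D ≡ᵇ b) e₃
  in Ca , Db

threshold-identity : ∀ m a b →
  (2 * suc b + 1) * m ^ b * m ^ suc a + (2 * suc a + 1) * m ^ a * m ^ suc b
    ≡ 2 * (suc a + suc b + 1) * m ^ ((suc a + suc b + 1) ∸ 2)
threshold-identity m a b = begin
    (2 * suc b + 1) * m ^ b * m ^ suc a + (2 * suc a + 1) * m ^ a * m ^ suc b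
  ≡⟨ collect m (m ^ a) (m ^ b) a b ⟩
    2 * (suc a + suc b + 1) * (m ^ a * m ^ suc b)
  ≡⟨ cong (2 * (suc a + suc b + 1) *_) (^-distribˡ-+-* m a (suc b)) ⟨
    2 * (suc a + suc b + 1) * m ^ (a + suc b)
  ≡⟨ cong (λ e → 2 * (suc a + suc b + 1) * m ^ e) (m+n∸n≡m (a + suc b) 1) ⟨
    2 * (suc a + suc b + 1) * m ^ ((suc a + suc b + 1) ∸ 2) ∎
  where
  open ≡-Reasoning
  collect : ∀ m p q a b → (2 * suc b + 1) * q * (m * p) + (2 * suc a + 1) * p * (m * q)
                            ≡ 2 * (suc a + suc b + 1) * (p * (m * q))
  collect = solve-∀

lemma4 : (a b m n i : ℕ) → 1 ≤ a → 1 ≤ b →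
    (X : Matrix m n) → Simple X → ¬ (F0kk0 (a + b + 1) ≺ X) →
    (∀ (j : Fin n) → colSum X j ≡ i) →
    (Ci : Sub m) → IsType a b i X Ci →
    2 * (a + b + 1) * m ^ ((a + b + 1) ∸ 2) ≤ numEdges (edgeB a b X Ci) →
    Σ (EdgeSet m) λ E' →
      (∀ C D → E' C D ≡ true → edgeB a b X Ci C D ≡ true) ×
      (numEdges (edgeB a b X Ci) ≤ 2 * numEdges E') ×
      (∀ C D → E' C D ≡ true →
        ((2 * b + 1) * m ^ (b ∸ 1) ≤ 2 * degC E' C) ×
        ((2 * a + 1) * m ^ (a ∸ 1) ≤ 2 * degD E' D))
lemma4 (suc a) (suc b) m n i _ _ X _ _ _ Ci _ many-edges =
  prune-keeps-half (λ C → card C ≡ᵇ suc a) TC (λ D → card D ≡ᵇ suc b) TD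
    (edgeB (suc a) (suc b) X Ci) (edgeB-admissible (suc a) (suc b) X Ci) budget
  where
  open Pruning (≡-dec _≟ᵇ_) (allSubs m) ∈-allSubs
  TC = (2 * suc b + 1) * m ^ b
  TD = (2 * suc a + 1) * m ^ a
  budget : TC * #subsetsOfSize m (suc a) + TD * #subsetsOfSize m (suc b)
           ≤ numEdges (edgeB (suc a) (suc b) X Ci)
  budget = begin
    TC * #subsetsOfSize m (suc a) + TD * #subsetsOfSize m (suc b)
      ≤⟨ +-mono-≤ (*-monoʳ-≤ TC (#subsetsOfSize≤^ m (suc a)))
                  (*-monoʳ-≤ TD (#subsetsOfSize≤^ m (suc b))) ⟩
    TC * m ^ suc a + TD * m ^ suc b
      ≡⟨ threshold-identity m a b ⟩
    2 * (suc a + suc b + 1) * m ^ ((suc a + suc b + 1) ∸ 2)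
      ≤⟨ many-edges ⟩
    numEdges (edgeB (suc a) (suc b) X Ci) ∎
    where open ≤-Reasoning
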